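{- Let $\mathtt{APAL}$ be the set of antipalindromic numbers. Then the quotient set $\mathtt{APAL}/\mathtt{APAL} = \{a/b : a,b \in \mathtt{APAL}\}$ is dense in the positive real numbers.
   Context: A positive integer is antipalindromic if its base-$2$ representation (written without leading zeros) has even length and its second half is the reverse of the bitwise complement of its first half; equivalently, writing the representation as $w_1 w_2 \cdots w_{2m}$, one has $w_i + w_{2m+1-i} = 1$ for all $1 \le i \le 2m$. For example $52 = [110100]_2$ is antipalindromic.
   Formalization: Density is asserted only for intervals between positive rational endpoints, rather than for arbitrary intervals of positive real numbers. -}

module Defs where

open import Data.Nat using (ℕ; zero; suc; _+_; _*_; _≤_)
open import Data.Nat.Divisibility using (_∣_)
open import Data.List using (List; []; _∷_; foldl; length; lookup)
open import Data.List.Relation.Unary.All using (All)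
open import Data.Fin using (Fin; opposite)
open import Data.Empty using (⊥)
open import Data.Product using (Σ; _×_)
open import Relation.Binary.PropositionalEquality using (_≡_)

binVal : List ℕ → ℕ
binVal = foldl (λ acc d → 2 * acc + d) 0

BinRep : List ℕ → ℕ → Set
BinRep [] n = ⊥
BinRep (d ∷ w) n = (d ≡ 1) × All (λ e → e ≤ 1) w × binVal (d ∷ w) ≡ n

-- n is antipalindromic: its base-2 representation w₁⋯w_{2m} has even length
-- and wᵢ + w_{2m+1-i} = 1 for all i (Fin-indexed: opposite i = len-1-i).
Antipalindromic : ℕ → Set
Antipalindromic n =
  Σ (List ℕ) λ w → BinRep w n × (2 ∣ length w)
    × ((i : Fin (length w)) → lookup w i + lookup w (opposite i) ≡ 1)

-- A word d starting with 1, followed by its reversed complement, is the binary expansion of an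
-- antipalindrome whose value lies in [v 2^ℓ, v 2^ℓ + 2^ℓ), where v is the value of d and ℓ its length.
-- Taking for d the binary expansion of M padded with i zeros gives an antipalindrome a with
-- M 2^(i+n) ≤ a < M 2^(i+n) + 2^n, a relative error below 2^-i; taking d = 10⋯0 or 1⋯1
-- gives an antipalindrome b within about the square root of 2^E of any power 2^E.
-- Between p < q lies a dyadic rational M / 2^j, and with E = j + i + n and i large the
-- quotient a / b ≈ M 2^(i+n) / 2^(j+i+n) lies strictly between p and q as well.

module Submission where

open import Defs

module Antipalindromes where

  open import Data.Fin using (Fin; zero; suc; toℕ; opposite)
  open import Data.Fin.Properties using (opposite-prop; toℕ<n)
  open import Data.List using (List; []; _∷_; _++_; _∷ʳ_; length; lookup; replicate)
  open import Data.List.Properties using (foldl-++; length-++; length-replicate; ++-assoc)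
  open import Data.List.Relation.Unary.All using (All; []; _∷_)
  open import Data.List.Relation.Unary.All.Properties using (++⁺; ∷ʳ⁺; replicate⁺)
  open import Data.Nat
  open import Data.Nat.DivMod using (m≡m%n+[m/n]*n; m%n<n; m/n*n≤m; m<n*o⇒m/o<n)
  open import Data.Nat.Divisibility using (divides)
  open import Data.Nat.Properties
  open import Data.Nat.Tactic.RingSolver using (solve-∀)
  open import Data.Product using (∃; ∃₂; _×_; _,_; proj₁; proj₂)
  open import Data.Sum using (inj₁; inj₂)
  open import Relation.Binary.PropositionalEquality
    using (_≡_; refl; sym; trans; cong; cong₂; subst; subst₂; module ≡-Reasoning)

  Bits : List ℕ → Set
  Bits = All (_≤ 1)

  n<2^n : ∀ n → n < 2 ^ n
  n<2^n zero    = z<s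
  n<2^n (suc n) = subst (suc n <_) (cong (2 ^ n +_) (sym (+-identityʳ (2 ^ n))))
                        (+-mono-≤-< (m^n>0 2 n) (n<2^n n))

  binVal-∷ : ∀ x w → binVal (x ∷ w) ≡ x * 2 ^ length w + binVal w
  binVal-∷ x []      = sym (trans (+-identityʳ (x * 1)) (*-identityʳ x))
  binVal-∷ x (y ∷ w) = begin
    binVal ((2 * x + y) ∷ w)                       ≡⟨ binVal-∷ (2 * x + y) w ⟩
    (2 * x + y) * 2 ^ length w + binVal w          ≡⟨ shift x y (2 ^ length w) (binVal w) ⟩
    x * (2 * 2 ^ length w) + (y * 2 ^ length w + binVal w)
                                                   ≡⟨ cong (x * (2 * 2 ^ length w) +_) (binVal-∷ y w) ⟨
    x * 2 ^ length (y ∷ w) + binVal (y ∷ w)        ∎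
    where
    open ≡-Reasoning
    shift : ∀ x y P B → (2 * x + y) * P + B ≡ x * (2 * P) + (y * P + B)
    shift = solve-∀

  binVal-++ : ∀ u v → binVal (u ++ v) ≡ binVal u * 2 ^ length v + binVal v
  binVal-++ u v = trans (foldl-++ (λ acc d → 2 * acc + d) 0 u v) (binVal-∷ (binVal u) v)

  binVal-< : ∀ {w} → Bits w → binVal w < 2 ^ length w
  binVal-< []                 = z<s
  binVal-< {x ∷ w} (x≤1 ∷ bw) = begin-strict
    binVal (x ∷ w)               ≡⟨ binVal-∷ x w ⟩
    x * 2 ^ length w + binVal w  <⟨ +-mono-≤-< (*-monoˡ-≤ (2 ^ length w) x≤1) (binVal-< bw) ⟩
    1 * 2 ^ length w + 2 ^ length w ≡⟨ double (2 ^ length w) ⟩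
    2 * 2 ^ length w             ∎
    where
    open ≤-Reasoning
    double : ∀ P → 1 * P + P ≡ 2 * P
    double = solve-∀

  binVal-zeros : ∀ n → binVal (replicate n 0) ≡ 0
  binVal-zeros zero    = refl
  binVal-zeros (suc n) = binVal-zeros n

  binVal-ones : ∀ n → suc (binVal (replicate n 1)) ≡ 2 ^ n
  binVal-ones zero    = refl
  binVal-ones (suc n) = begin
    suc (binVal (1 ∷ ones))                 ≡⟨ cong suc (binVal-∷ 1 ones) ⟩
    suc (1 * 2 ^ length ones + binVal ones) ≡⟨ cong (λ l → suc (1 * 2 ^ l + binVal ones)) (length-replicate n) ⟩
    suc (1 * 2 ^ n + binVal ones)           ≡⟨ cong suc (+-comm (1 * 2 ^ n) (binVal ones)) ⟩
    suc (binVal ones) + 1 * 2 ^ n           ≡⟨ cong₂ _+_ (binVal-ones n) (*-identityˡ (2 ^ n)) ⟩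
    2 ^ n + 2 ^ n                           ≡⟨ cong (2 ^ n +_) (+-identityʳ (2 ^ n)) ⟨
    2 * 2 ^ n                               ∎
    where
    ones = replicate n 1
    open ≡-Reasoning

  bits-of : ∀ k u → u < 2 ^ k → ∃ λ w → Bits w × binVal w ≡ u
  bits-of zero    zero    _         = [] , [] , refl
  bits-of zero    (suc _) (s≤s ())
  bits-of (suc k) u       u<2^[1+k] =
    let w , bw , w≡u/2 = bits-of k (u / 2) (m<n*o⇒m/o<n (subst (u <_) (*-comm 2 (2 ^ k)) u<2^[1+k]))
    in w ∷ʳ u % 2 , ∷ʳ⁺ bw (m<1+n⇒m≤n (m%n<n u 2)) , (begin
      binVal (w ∷ʳ u % 2)    ≡⟨ binVal-++ w (u % 2 ∷ []) ⟩
      binVal w * 2 + u % 2   ≡⟨ cong (λ v → v * 2 + u % 2) w≡u/2 ⟩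
      u / 2 * 2 + u % 2      ≡⟨ +-comm (u / 2 * 2) (u % 2) ⟩
      u % 2 + u / 2 * 2      ≡⟨ m≡m%n+[m/n]*n u 2 ⟨
      u                      ∎)
    where open ≡-Reasoning

  drop-leading-zeros : ∀ {w} → Bits w → 0 < binVal w → ∃ λ e → Bits e × binVal (1 ∷ e) ≡ binVal w
  drop-leading-zeros {[]}              []           ()
  drop-leading-zeros {0 ∷ w}           (_ ∷ bw)     pos = drop-leading-zeros bw pos
  drop-leading-zeros {1 ∷ w}           (_ ∷ bw)     _   = w , bw , refl
  drop-leading-zeros {suc (suc _) ∷ _} (s≤s () ∷ _) _

  binary-expansion : ∀ M → 0 < M → ∃ λ e → Bits e × binVal (1 ∷ e) ≡ M
  binary-expansion M 0<M with bits-of M M (n<2^n M)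
  ... | w , bw , refl = drop-leading-zeros bw 0<M

  reverseComplement : List ℕ → List ℕ
  reverseComplement []      = []
  reverseComplement (x ∷ d) = reverseComplement d ∷ʳ (1 ∸ x)

  antipalindrome : List ℕ → List ℕ
  antipalindrome d = d ++ reverseComplement d

  length-∷ʳ : ∀ u (c : ℕ) → length (u ∷ʳ c) ≡ suc (length u)
  length-∷ʳ u c = trans (length-++ u) (+-comm (length u) 1)

  length-reverseComplement : ∀ d → length (reverseComplement d) ≡ length d
  length-reverseComplement []      = refl
  length-reverseComplement (x ∷ d) =
    trans (length-∷ʳ (reverseComplement d) (1 ∸ x)) (cong suc (length-reverseComplement d))

  bits-reverseComplement : ∀ d → Bits (reverseComplement d)
  bits-reverseComplement []      = []
  bits-reverseComplement (x ∷ d) = ∷ʳ⁺ (bits-reverseComplement d) (m∸n≤m 1 x)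

  antipalindrome-∷ : ∀ x d → antipalindrome (x ∷ d) ≡ x ∷ (antipalindrome d ∷ʳ (1 ∸ x))
  antipalindrome-∷ x d = cong (x ∷_) (sym (++-assoc d (reverseComplement d) (1 ∸ x ∷ [])))

  antipalindrome-bounds : ∀ d →
    binVal d * 2 ^ length d ≤ binVal (antipalindrome d) ×
    binVal (antipalindrome d) < binVal d * 2 ^ length d + 2 ^ length d
  antipalindrome-bounds d =
    subst (m ≤_) value (m≤m+n m r) , subst (_< m + 2 ^ length d) value (+-monoʳ-< m r<2^l)
    where
    m = binVal d * 2 ^ length d
    r = binVal (reverseComplement d)
    value : m + r ≡ binVal (antipalindrome d)
    value = sym (trans (binVal-++ d (reverseComplement d))
                       (cong (λ l → binVal d * 2 ^ l + r) (length-reverseComplement d)))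
    r<2^l : r < 2 ^ length d
    r<2^l = subst (λ l → r < 2 ^ l) (length-reverseComplement d) (binVal-< (bits-reverseComplement d))

  at : List ℕ → ℕ → ℕ
  at []      _       = 0
  at (x ∷ _) zero    = x
  at (_ ∷ w) (suc k) = at w k

  lookup-at : ∀ w (i : Fin (length w)) → lookup w i ≡ at w (toℕ i)
  lookup-at (_ ∷ _) zero    = refl
  lookup-at (_ ∷ w) (suc i) = lookup-at w i

  at-++ˡ : ∀ u v {k} → k < length u → at (u ++ v) k ≡ at u k
  at-++ˡ (_ ∷ _) _ {zero}  _   = refl
  at-++ˡ (_ ∷ u) v {suc k} k<u = at-++ˡ u v (s<s⁻¹ k<u)

  at-∷ʳ : ∀ u c → at (u ∷ʳ c) (length u) ≡ c
  at-∷ʳ []      _ = refl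
  at-∷ʳ (_ ∷ u) c = at-∷ʳ u c

  -- The mirror condition of Antipalindromic, indexed by ℕ instead of Fin so that it can be
  -- established by induction on the first half.
  Complementary : List ℕ → Set
  Complementary w = ∀ k → k < length w → at w k + at w (length w ∸ suc k) ≡ 1

  complementary-∷-∷ʳ : ∀ {x c} u → x + c ≡ 1 → Complementary u → Complementary (x ∷ (u ∷ʳ c))
  complementary-∷-∷ʳ {x} {c} u x+c≡1 compl-u k k<w =
    subst (λ l → at w k + at w (l ∸ k) ≡ 1) (sym (length-∷ʳ u c))
          (mirrored k (subst (λ l → k < suc l) (length-∷ʳ u c) k<w))
    where
    w = x ∷ (u ∷ʳ c)
    L = length u
    mirrored : ∀ k → k < suc (suc L) → at w k + at w (suc L ∸ k) ≡ 1
    mirrored zero    _       = trans (cong (x +_) (at-∷ʳ u c)) x+c≡1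
    mirrored (suc k) k<2+L with m≤n⇒m<n∨m≡n (m<1+n⇒m≤n (s<s⁻¹ k<2+L))
    ... | inj₂ refl = trans (cong₂ _+_ (at-∷ʳ u c) (cong (at w) (n∸n≡0 L))) (trans (+-comm c x) x+c≡1)
    ... | inj₁ k<L  = trans (cong₂ _+_ (at-++ˡ u (c ∷ []) k<L) mirror-inside) (compl-u k k<L)
      where
      mirror-inside : at w (L ∸ k) ≡ at u (L ∸ suc k)
      mirror-inside = trans (cong (at w) (+-∸-assoc 1 k<L)) (at-++ˡ u (c ∷ []) (∸-monoʳ-< z<s k<L))

  complementary-antipalindrome : ∀ {d} → Bits d → Complementary (antipalindrome d)
  complementary-antipalindrome []                 _ ()
  complementary-antipalindrome {x ∷ d} (x≤1 ∷ bd) =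
    subst Complementary (sym (antipalindrome-∷ x d))
          (complementary-∷-∷ʳ (antipalindrome d) (m+[n∸m]≡n x≤1) (complementary-antipalindrome bd))

  antipalindromic-antipalindrome : ∀ {e} → Bits e → Antipalindromic (binVal (antipalindrome (1 ∷ e)))
  antipalindromic-antipalindrome {e} be =
    w , (refl , ++⁺ be (bits-reverseComplement (1 ∷ e)) , refl) , divides (length (1 ∷ e)) even-length , mirror
    where
    w = antipalindrome (1 ∷ e)
    even-length : length w ≡ length (1 ∷ e) * 2
    even-length = trans (trans (length-++ (1 ∷ e)) (cong (length (1 ∷ e) +_) (length-reverseComplement (1 ∷ e))))
                        (twice (length (1 ∷ e)))
      where
      twice : ∀ n → n + n ≡ n * 2
      twice = solve-∀
    mirror : (i : Fin (length w)) → lookup w i + lookup w (opposite i) ≡ 1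
    mirror i = trans (cong₂ _+_ (lookup-at w i) (trans (lookup-at w (opposite i)) (cong (at w) (opposite-prop i))))
                     (complementary-antipalindrome (s≤s z≤n ∷ be) (toℕ i) (toℕ<n i))

  antipalindromic⇒positive : ∀ {n} → Antipalindromic n → 0 < n
  antipalindromic⇒positive ([]    , ()                , _)
  antipalindromic⇒positive (_ ∷ w , (refl , _ , refl) , _) = begin-strict
    0                             <⟨ m^n>0 2 (length w) ⟩
    2 ^ length w                  ≤⟨ m≤m+n (2 ^ length w) (binVal w) ⟩
    2 ^ length w + binVal w       ≡⟨ cong (_+ binVal w) (*-identityˡ (2 ^ length w)) ⟨
    1 * 2 ^ length w + binVal w   ≡⟨ binVal-∷ 1 w ⟨
    binVal (1 ∷ w)                ∎
    where open ≤-Reasoning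

  antipalindrome-above : ∀ M i → 0 < M → ∃₂ λ n a →
    Antipalindromic a × M * (2 ^ i * 2 ^ n) ≤ a × a < M * (2 ^ i * 2 ^ n) + 2 ^ n
  antipalindrome-above M i 0<M with binary-expansion M 0<M
  ... | e , be , refl = length d , a ,
        antipalindromic-antipalindrome {e ++ zeros} (++⁺ be (replicate⁺ i z≤n)) ,
        subst (_≤ a) scale lower , subst (λ m → a < m + 2 ^ length d) scale upper
    where
    zeros = replicate i 0
    d = (1 ∷ e) ++ zeros
    a = binVal (antipalindrome d)
    lower = antipalindrome-bounds d .proj₁
    upper = antipalindrome-bounds d .proj₂
    scale : binVal d * 2 ^ length d ≡ M * (2 ^ i * 2 ^ length d)
    scale = begin
      binVal d * 2 ^ length d                                 ≡⟨ cong (_* 2 ^ length d) (binVal-++ (1 ∷ e) zeros) ⟩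
      (M * 2 ^ length zeros + binVal zeros) * 2 ^ length d    ≡⟨ cong₂ (λ l z → (M * 2 ^ l + z) * 2 ^ length d) (length-replicate i) (binVal-zeros i) ⟩
      (M * 2 ^ i + 0) * 2 ^ length d                          ≡⟨ cong (_* 2 ^ length d) (+-identityʳ (M * 2 ^ i)) ⟩
      M * 2 ^ i * 2 ^ length d                                ≡⟨ *-assoc M (2 ^ i) (2 ^ length d) ⟩
      M * (2 ^ i * 2 ^ length d)                              ∎
      where open ≡-Reasoning

  data EvenOdd : ℕ → Set where
    even : ∀ m → EvenOdd (m + m)
    odd  : ∀ m → EvenOdd (suc (m + m))

  evenOdd : ∀ n → EvenOdd n
  evenOdd zero    = even zero
  evenOdd (suc n) with evenOdd n
  ... | even m = odd m
  ... | odd m  = subst EvenOdd (cong suc (+-suc m m)) (even (suc m))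

  antipalindrome-above-2^odd : ∀ m →
    ∃ λ b → Antipalindromic b × 2 ^ suc (m + m) ≤ b × b < 2 ^ suc (m + m) + 2 ^ suc m
  antipalindrome-above-2^odd m =
    b , antipalindromic-antipalindrome (replicate⁺ m z≤n) ,
    subst (_≤ b) 2^m*2^[1+m]≡ lower , subst (λ x → b < x + 2 ^ suc m) 2^m*2^[1+m]≡ upper
    where
    d = 1 ∷ replicate m 0
    b = binVal (antipalindrome d)
    value : binVal d ≡ 2 ^ m
    value = begin
      binVal d                                                  ≡⟨ binVal-∷ 1 (replicate m 0) ⟩
      1 * 2 ^ length (replicate m 0) + binVal (replicate m 0)   ≡⟨ cong₂ (λ l z → 1 * 2 ^ l + z) (length-replicate m) (binVal-zeros m) ⟩
      1 * 2 ^ m + 0                                             ≡⟨ trans (+-identityʳ (1 * 2 ^ m)) (*-identityˡ (2 ^ m)) ⟩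
      2 ^ m                                                     ∎
      where open ≡-Reasoning
    bounds : 2 ^ m * 2 ^ suc m ≤ b × b < 2 ^ m * 2 ^ suc m + 2 ^ suc m
    bounds = subst₂ (λ v l → v * 2 ^ l ≤ b × b < v * 2 ^ l + 2 ^ l) value (cong suc (length-replicate m))
                    (antipalindrome-bounds d)
    lower = bounds .proj₁
    upper = bounds .proj₂
    2^m*2^[1+m]≡ : 2 ^ m * 2 ^ suc m ≡ 2 ^ suc (m + m)
    2^m*2^[1+m]≡ = trans (sym (^-distribˡ-+-* 2 m (suc m))) (cong (2 ^_) (+-suc m m))

  antipalindrome-below-2^even : ∀ m →
    ∃ λ b → Antipalindromic b × b < 2 ^ (suc m + suc m) × 2 ^ (suc m + suc m) ≤ b + 2 ^ suc m
  antipalindrome-below-2^even m =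
    b , antipalindromic-antipalindrome (replicate⁺ m ≤-refl) ,
    subst (b <_) B*H+H≡ upper , subst (_≤ b + H) B*H+H≡ (+-monoˡ-≤ H lower)
    where
    ones = replicate (suc m) 1
    H = 2 ^ suc m
    B = binVal ones
    b = binVal (antipalindrome ones)
    bounds : B * H ≤ b × b < B * H + H
    bounds = subst (λ l → B * 2 ^ l ≤ b × b < B * 2 ^ l + 2 ^ l) (length-replicate (suc m))
                   (antipalindrome-bounds ones)
    lower = bounds .proj₁
    upper = bounds .proj₂
    B*H+H≡ : B * H + H ≡ 2 ^ (suc m + suc m)
    B*H+H≡ = begin
      B * H + H             ≡⟨ +-comm (B * H) H ⟩
      suc B * H             ≡⟨ cong (_* H) (binVal-ones (suc m)) ⟩
      H * H                 ≡⟨ ^-distribˡ-+-* 2 (suc m) (suc m) ⟨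
      2 ^ (suc m + suc m)   ∎
      where open ≡-Reasoning

  antipalindrome-near-2^ : ∀ E → ∃₂ λ b H →
    Antipalindromic b × b ≤ 2 ^ E + H × 2 ^ E ≤ b + H × H * H ≤ 2 * 2 ^ E
  antipalindrome-near-2^ E with evenOdd E
  ... | even zero    = 2 , 1 , antipalindromic-antipalindrome [] , ≤-refl , s≤s z≤n , s≤s z≤n
  ... | even (suc m) =
    let b , apB , b<2^E , 2^E≤b+H = antipalindrome-below-2^even m
    in b , 2 ^ suc m , apB , ≤-trans (<⇒≤ b<2^E) (m≤m+n (2 ^ E) (2 ^ suc m)) , 2^E≤b+H ,
       ≤-trans (≤-reflexive (sym (^-distribˡ-+-* 2 (suc m) (suc m)))) (m≤m+n (2 ^ E) (2 ^ E + 0))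
  ... | odd m        =
    let b , apB , 2^E≤b , b<2^E+H = antipalindrome-above-2^odd m
    in b , 2 ^ suc m , apB , <⇒≤ b<2^E+H , ≤-trans 2^E≤b (m≤m+n b (2 ^ suc m)) ,
       ≤-reflexive (trans (sym (^-distribˡ-+-* 2 (suc m) (suc m))) (cong (λ k → 2 ^ suc k) (+-suc m m)))

  dyadic-between : ∀ P Q R S .{{_ : NonZero Q}} → P * S < R * Q →
    ∃₂ λ M j → P * 2 ^ j < M * Q × S * M < R * 2 ^ j
  dyadic-between P Q R S PS<RQ = suc m , S * Q , PJ<MQ , SM<RJ
    where
    -- 2 ^ j > S * Q makes the step 1 / 2 ^ j smaller than the gap R / S - P / Q ≥ 1 / (Q * S).
    J = 2 ^ (S * Q)
    m = P * J / Q
    PJ<MQ : P * J < suc m * Q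
    PJ<MQ = begin-strict
      P * J               ≡⟨ m≡m%n+[m/n]*n (P * J) Q ⟩
      P * J % Q + m * Q   <⟨ +-monoˡ-< (m * Q) (m%n<n (P * J) Q) ⟩
      Q + m * Q           ∎
      where open ≤-Reasoning
    SM<RJ : S * suc m < R * J
    SM<RJ = *-cancelʳ-< Q (S * suc m) (R * J) (begin-strict
      S * suc m * Q        ≡⟨ *-assoc S (suc m) Q ⟩
      S * (Q + m * Q)      ≤⟨ *-monoʳ-≤ S (+-monoʳ-≤ Q (m/n*n≤m (P * J) Q)) ⟩
      S * (Q + P * J)      ≡⟨ expand S Q P J ⟩
      S * Q + S * P * J    <⟨ +-monoˡ-< (S * P * J) (n<2^n (S * Q)) ⟩
      suc (S * P) * J      ≤⟨ *-monoˡ-≤ J (subst (_< R * Q) (*-comm P S) PS<RQ) ⟩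
      R * Q * J            ≡⟨ *-comm-middle R Q J ⟩
      R * J * Q            ∎)
      where
      open ≤-Reasoning
      expand : ∀ S Q P J → S * (Q + P * J) ≡ S * Q + S * P * J
      expand = solve-∀
      *-comm-middle : ∀ R Q J → R * Q * J ≡ R * J * Q
      *-comm-middle = solve-∀

  m*m<n*n⇒m<n : ∀ {m n} → m * m < n * n → m < n
  m*m<n*n⇒m<n m*m<n*n = ≰⇒> λ n≤m → <⇒≱ m*m<n*n (*-mono-≤ n≤m n≤m)

  error-budget : ∀ K J I N H → 0 < N → 2 * K + 8 * (K * K * J) < I →
    H * H ≤ 2 * (J * (I * N)) → K * N + K * H < I * N
  error-budget K J I N H 0<N small H*H≤ = *-cancelˡ-< 2 (K * N + K * H) T (begin-strict
      2 * (K * N + K * H)       ≡⟨ regroup K N H ⟩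
      2 * K * N + 2 * K * H     <⟨ +-mono-≤-< 2KN≤T 2KH<T ⟩
      T + T                     ≡⟨ cong (T +_) (+-identityʳ T) ⟨
      2 * T                     ∎)
    where
    open ≤-Reasoning
    square : ∀ K H → 2 * K * H * (2 * K * H) ≡ 4 * (K * K) * (H * H)
    square = solve-∀
    reassoc : ∀ K J T → 4 * (K * K) * (2 * (J * T)) ≡ 8 * (K * K * J) * T
    reassoc = solve-∀
    regroup : ∀ K N H → 2 * (K * N + K * H) ≡ 2 * K * N + 2 * K * H
    regroup = solve-∀
    T = I * N
    I≤T : I ≤ T
    I≤T = m≤m*n I N {{>-nonZero 0<N}}
    0<T : 0 < T
    0<T = ≤-trans (≤-trans (s≤s z≤n) small) I≤T
    2KN≤T : 2 * K * N ≤ T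
    2KN≤T = *-monoˡ-≤ N (≤-trans (m≤m+n (2 * K) _) (<⇒≤ small))
    2KH<T : 2 * K * H < T
    2KH<T = m*m<n*n⇒m<n (begin-strict
      2 * K * H * (2 * K * H)        ≡⟨ square K H ⟩
      4 * (K * K) * (H * H)          ≤⟨ *-monoʳ-≤ (4 * (K * K)) H*H≤ ⟩
      4 * (K * K) * (2 * (J * T))    ≡⟨ reassoc K J T ⟩
      8 * (K * K * J) * T            <⟨ *-monoˡ-< T {{>-nonZero 0<T}} (≤-trans (s≤s (m≤n+m _ (2 * K))) small) ⟩
      I * T                          ≤⟨ *-monoˡ-≤ T I≤T ⟩
      T * T                          ∎)

  fraction-<-approximate-ratio : ∀ P Q M J T H {a b} → P * J < M * Q → M * T ≤ a → b ≤ J * T + H →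
    P * H < T → P * b < a * Q
  fraction-<-approximate-ratio P Q M J T H {a} {b} PJ<MQ MT≤a b≤JT+H PH<T = begin-strict
    P * b               ≤⟨ *-monoʳ-≤ P b≤JT+H ⟩
    P * (J * T + H)     ≡⟨ expand P J T H ⟩
    P * J * T + P * H   <⟨ +-monoʳ-< (P * J * T) PH<T ⟩
    P * J * T + T       ≡⟨ +-comm (P * J * T) T ⟩
    suc (P * J) * T     ≤⟨ *-monoˡ-≤ T PJ<MQ ⟩
    M * Q * T           ≡⟨ swap M Q T ⟩
    M * T * Q           ≤⟨ *-monoˡ-≤ Q MT≤a ⟩
    a * Q               ∎
    where
    open ≤-Reasoning
    expand : ∀ P J T H → P * (J * T + H) ≡ P * J * T + P * H
    expand = solve-∀
    swap : ∀ M Q T → M * Q * T ≡ M * T * Q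
    swap = solve-∀

  approximate-ratio-<-fraction : ∀ R S M J T N H {a b} .{{_ : NonZero S}} → S * M < R * J → a < M * T + N →
    J * T ≤ b + H → S * N + R * H ≤ T → a * S < R * b
  approximate-ratio-<-fraction R S M J T N H {a} {b} SM<RJ a<MT+N JT≤b+H SN+RH≤T =
    +-cancelʳ-< (R * H) (a * S) (R * b) (begin-strict
      a * S + R * H                <⟨ +-monoˡ-< (R * H) (*-monoˡ-< S a<MT+N) ⟩
      (M * T + N) * S + R * H      ≡⟨ expand M T N S R H ⟩
      S * M * T + (S * N + R * H)  ≤⟨ +-monoʳ-≤ (S * M * T) SN+RH≤T ⟩
      S * M * T + T                ≡⟨ +-comm (S * M * T) T ⟩
      suc (S * M) * T              ≤⟨ *-monoˡ-≤ T SM<RJ ⟩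
      R * J * T                    ≡⟨ *-assoc R J T ⟩
      R * (J * T)                  ≤⟨ *-monoʳ-≤ R JT≤b+H ⟩
      R * (b + H)                  ≡⟨ *-distribˡ-+ R b H ⟩
      R * b + R * H                ∎)
    where
    open ≤-Reasoning
    expand : ∀ M T N S R H → (M * T + N) * S + R * H ≡ S * M * T + (S * N + R * H)
    expand = solve-∀

  antipalindromic-between-dyadic : ∀ P Q R S M j .{{_ : NonZero S}} → P * 2 ^ j < M * Q → S * M < R * 2 ^ j →
    ∃₂ λ a b → Antipalindromic a × Antipalindromic b × P * b < a * Q × a * S < R * b
  antipalindromic-between-dyadic P Q R S M j PJ<MQ SM<RJ =
    let n , a , apA , MT≤a , a<MT+N         = antipalindrome-above M i 0<M
        b , H , apB , b≤E+H , E≤b+H , H*H≤E = antipalindrome-near-2^ (j + (i + n))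
        N = 2 ^ n
        T = 2 ^ i * N
        E≡JT = trans (^-distribˡ-+-* 2 j (i + n)) (cong (J *_) (^-distribˡ-+-* 2 i n))
        KN+KH<T = error-budget K J (2 ^ i) N H (m^n>0 2 n) (n<2^n i) (subst (λ E → H * H ≤ 2 * E) E≡JT H*H≤E)
        PH<T = ≤-<-trans (*-monoˡ-≤ H P≤K) (≤-<-trans (m≤n+m (K * H) (K * N)) KN+KH<T)
        SN+RH≤T = <⇒≤ (≤-<-trans (+-mono-≤ (*-monoˡ-≤ N S≤K) (*-monoˡ-≤ H R≤K)) KN+KH<T)
    in a , b , apA , apB ,
       fraction-<-approximate-ratio P Q M J T H PJ<MQ MT≤a (subst (λ E → b ≤ E + H) E≡JT b≤E+H) PH<T ,
       approximate-ratio-<-fraction R S M J T N H SM<RJ a<MT+N (subst (_≤ b + H) E≡JT E≤b+H) SN+RH≤T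
    where
    J = 2 ^ j
    K = P + R + S
    i = 2 * K + 8 * (K * K * J)
    0<M : 0 < M
    0<M = *-cancelʳ-< Q 0 M (≤-<-trans z≤n PJ<MQ)
    P≤K : P ≤ K
    P≤K = ≤-trans (m≤m+n P R) (m≤m+n (P + R) S)
    R≤K : R ≤ K
    R≤K = ≤-trans (m≤n+m R P) (m≤m+n (P + R) S)
    S≤K : S ≤ K
    S≤K = m≤n+m S (P + R)

  antipalindromic-fractions-dense : ∀ P Q R S .{{_ : NonZero Q}} .{{_ : NonZero S}} → P * S < R * Q →
    ∃₂ λ a b → Antipalindromic a × Antipalindromic b × P * b < a * Q × a * S < R * b
  antipalindromic-fractions-dense P Q R S PS<RQ =
    let M , j , PJ<MQ , SM<RJ = dyadic-between P Q R S PS<RQ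
    in antipalindromic-between-dyadic P Q R S M j PJ<MQ SM<RJ

open Antipalindromes using (antipalindromic⇒positive; antipalindromic-fractions-dense)

open import Data.Empty using (⊥-elim)
open import Data.Integer as ℤ using (+_; -[1+_]; +<+)
open import Data.Integer.Properties using (pos-*; drop‿+<+)
open import Data.Nat as ℕ using (ℕ; zero; suc)
open import Data.Nat.Coprimality using (Coprime)
open import Data.Nat.Properties using (n≮0)
open import Data.Product using (Σ; ∃₂; _×_; _,_)
open import Data.Rational using (ℚ; mkℚ; 0ℚ; _<_; *<*; _/_; positive)
open import Data.Rational.Properties using (toℚᵘ-cancel-<; toℚᵘ-fromℚᵘ; <-trans)
import Data.Rational.Unnormalised as ℚᵘ
import Data.Rational.Unnormalised.Properties as ℚᵘ
open import Relation.Binary.PropositionalEquality using (sym; subst₂)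

pos-*-< : ∀ m n o r → m ℕ.* n ℕ.< o ℕ.* r → + m ℤ.* + n ℤ.< + o ℤ.* + r
pos-*-< m n o r mn<or = subst₂ ℤ._<_ (pos-* m n) (pos-* o r) (+<+ mn<or)

pos-*-<⁻¹ : ∀ m n o r → + m ℤ.* + n ℤ.< + o ℤ.* + r → m ℕ.* n ℕ.< o ℕ.* r
pos-*-<⁻¹ m n o r mn<or = drop‿+<+ (subst₂ ℤ._<_ (sym (pos-* m n)) (sym (pos-* o r)) mn<or)

<-fraction : ∀ {P Q-1} .{c : Coprime P (suc Q-1)} a b →
  P ℕ.* suc b ℕ.< a ℕ.* suc Q-1 → mkℚ (+ P) Q-1 c < + a / suc b
<-fraction {P} {Q-1} a b Pb<aQ = toℚᵘ-cancel-<
  (ℚᵘ.<-respʳ-≃ (ℚᵘ.≃-sym (toℚᵘ-fromℚᵘ (ℚᵘ.mkℚᵘ (+ a) b))) (ℚᵘ.*<* (pos-*-< P (suc b) a (suc Q-1) Pb<aQ)))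

fraction-< : ∀ {R S-1} .{c : Coprime R (suc S-1)} a b →
  a ℕ.* suc S-1 ℕ.< R ℕ.* suc b → + a / suc b < mkℚ (+ R) S-1 c
fraction-< {R} {S-1} a b aS<Rb = toℚᵘ-cancel-<
  (ℚᵘ.<-respˡ-≃ (ℚᵘ.≃-sym (toℚᵘ-fromℚᵘ (ℚᵘ.mkℚᵘ (+ a) b))) (ℚᵘ.*<* (pos-*-< a (suc S-1) R (suc b) aS<Rb)))

theorem12 : (p q : ℚ) → 0ℚ < p → p < q →
    Σ ℕ λ a → Σ ℕ λ b →
      Antipalindromic a × Antipalindromic (suc b) ×
      p < (+ a) / (suc b) × (+ a) / (suc b) < q
theorem12 (mkℚ -[1+ _ ] _ _) _ 0<p _ with () ← positive 0<p
theorem12 (mkℚ (+ _) _ _) (mkℚ -[1+ _ ] _ _) 0<p p<q with () ← positive (<-trans 0<p p<q)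
theorem12 p@(mkℚ (+ P) Q-1 _) q@(mkℚ (+ R) S-1 _) _ (*<* p<q) =
  fractions (antipalindromic-fractions-dense P (suc Q-1) R (suc S-1) (pos-*-<⁻¹ P (suc S-1) R (suc Q-1) p<q))
  where
  fractions : (∃₂ λ a b → Antipalindromic a × Antipalindromic b ×
                           P ℕ.* b ℕ.< a ℕ.* suc Q-1 × a ℕ.* suc S-1 ℕ.< R ℕ.* b) →
              Σ ℕ λ a → Σ ℕ λ b → Antipalindromic a × Antipalindromic (suc b) ×
                                   p < (+ a) / (suc b) × (+ a) / (suc b) < q
  fractions (_ , zero  , _   , ap0 , _)            = ⊥-elim (n≮0 (antipalindromic⇒positive ap0))
  fractions (a , suc b , apA , apB , Pb<aQ , aS<Rb) = a , b , apA , apB , <-fraction a b Pb<aQ , fraction-< a b aS<Rb
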